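{- Let $\mathbb{F}_q$ be a finite field, $k\ge 1$, $a\in\mathbb{F}_q[x_1,\dots,x_k]$, and let $\mathcal{A}=(P,Q)$ be either $(\{a\},\emptyset)$ or $(\emptyset,\{a\})$. Let $\boldsymbol{\alpha}\in\mathbb{F}_q^{k-1}$ be such that there is no $\beta\in\mathbb{F}_q$ with $(\boldsymbol{\alpha},\beta)\in\mathrm{zero}_q(P/Q)$. Write $a=c_1x_k^{d_1}+\dots+c_mx_k^{d_m}$ with pairwise distinct $d_i$ and $c_i\in\mathbb{F}_q[x_1,\dots,x_{k-1}]$, let $\gamma_i=c_i(\boldsymbol{\alpha})\in\mathbb{F}_q$, and let $\mathrm{Proj_{Coeff}}(\mathcal{A},\boldsymbol{\alpha})=\Delta=\{(\emptyset,\{c_i-\gamma_i\})\mid 1\le i\le m\}$. Then $\Delta$ is a weak projecting zero decomposition of $\mathcal{A}$ for $\boldsymbol{\alpha}$, i.e. every system in $\Delta$ consists of polynomials in $\mathbb{F}_q[x_1,\dots,x_{k-1}]$, $\mathrm{proj}_k\mathrm{zero}_q(P/Q)\subseteq\bigcup_{(P',Q')\in\Delta}\mathrm{zero}_q(P'/Q')$, and $\boldsymbol{\alpha}\notin\mathrm{zero}_q(P'/Q')$ for every $(P',Q')\in\Delta$.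
   Context: For finite $P,Q\subset\mathbb{F}_q[x_1,\dots,x_k]$, $\mathrm{zero}_q(P/Q)=\{\boldsymbol{\xi}\in\mathbb{F}_q^k\mid p(\boldsymbol{\xi})=0\ \forall p\in P,\ q(\boldsymbol{\xi})\neq 0\ \forall q\in Q\}$, and $\mathrm{proj}_k\mathrm{zero}_q(P/Q)=\{\boldsymbol{\alpha}\in\mathbb{F}_q^{k-1}\mid\exists\beta\in\mathbb{F}_q:(\boldsymbol{\alpha},\beta)\in\mathrm{zero}_q(P/Q)\}$; for systems with polynomials in $\mathbb{F}_q[x_1,\dots,x_{k-1}]$, $\mathrm{zero}_q$ is the analogous subset of $\mathbb{F}_q^{k-1}$. -}

module Defs where

open import Level using (Level; _⊔_; Lift)
open import Data.Nat using (ℕ; zero; suc)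
open import Data.Product using (Σ; ∃; _×_; _,_)
open import Data.List using (List; []; _∷_; [_]; replicate; _++_; map; foldr)
open import Data.List.Relation.Unary.All using (All)
open import Data.List.Relation.Unary.Any using (Any)
open import Data.Vec using (Vec; init; last)
open import Relation.Nullary using (¬_; Dec)
open import Data.Unit using (⊤)
open import Algebra.Bundles using (CommutativeRing)

record FiniteField (c ℓ : Level) : Set (Level.suc (c ⊔ ℓ)) where
  field
    commRing : CommutativeRing c ℓ
  open CommutativeRing commRing public
  field
    0≉1      : ¬ (0# ≈ 1#)
    inverse  : ∀ x → ¬ (x ≈ 0#) → Σ Carrier (λ y → (x * y) ≈ 1#)
    _≟_      : ∀ x y → Dec (x ≈ y)
    elements : List Carrier
    complete : ∀ x → Any (λ y → x ≈ y) elements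

module Polynomials {c ℓ : Level} (F : FiniteField c ℓ) where
  open FiniteField F hiding (zero)

  -- Poly k = F[x_1,...,x_k], in recursive dense representation:
  -- Poly (suc k) = (F[x_1,...,x_k])[x_{k+1}], a list of coefficients
  -- in the last variable, lowest degree first.
  data Poly : ℕ → Set c where
    con  : Carrier → Poly zero
    poly : ∀ {k} → List (Poly k) → Poly (suc k)

  0P : ∀ {k} → Poly k
  0P {zero}  = con 0#
  0P {suc k} = poly []

  constP : ∀ {k} → Carrier → Poly k
  constP {zero}  x = con x
  constP {suc k} x = poly (constP x ∷ [])

  addL : ∀ {k} → (Poly k → Poly k → Poly k) → List (Poly k) → List (Poly k) → List (Poly k)
  addL f [] ys = ys
  addL f (x ∷ xs) [] = x ∷ xs
  addL f (x ∷ xs) (y ∷ ys) = f x y ∷ addL f xs ys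

  infixl 6 _+P_
  _+P_ : ∀ {k} → Poly k → Poly k → Poly k
  con x   +P con y   = con (x + y)
  poly xs +P poly ys = poly (addL _+P_ xs ys)

  _-C_ : ∀ {k} → Poly k → Carrier → Poly k
  p -C γ = p +P constP (- γ)

  monomial : ∀ {k} → Poly k → ℕ → Poly (suc k)
  monomial p d = poly (replicate d 0P ++ [ p ])

  -- equality of polynomials (coefficientwise, up to trailing zeros)
  IsZeroP : ∀ {k} → Poly k → Set (c ⊔ ℓ)
  IsZeroL : ∀ {k} → List (Poly k) → Set (c ⊔ ℓ)
  IsZeroP (con x)   = Lift c (x ≈ 0#)
  IsZeroP (poly xs) = IsZeroL xs
  IsZeroL []       = Lift (c ⊔ ℓ) ⊤
  IsZeroL (x ∷ xs) = IsZeroP x × IsZeroL xs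

  infix 4 _≃P_
  _≃P_ : ∀ {k} → Poly k → Poly k → Set (c ⊔ ℓ)
  _≃L_ : ∀ {k} → List (Poly k) → List (Poly k) → Set (c ⊔ ℓ)
  con x   ≃P con y   = Lift c (x ≈ y)
  poly xs ≃P poly ys = xs ≃L ys
  []       ≃L ys       = IsZeroL ys
  (x ∷ xs) ≃L []       = IsZeroL (x ∷ xs)
  (x ∷ xs) ≃L (y ∷ ys) = (x ≃P y) × (xs ≃L ys)

  horner : List Carrier → Carrier → Carrier
  horner []       β = 0#
  horner (x ∷ xs) β = x + β * horner xs β

  -- evaluation at a point of F^k (last coordinate = last variable)
  eval : ∀ {k} → Poly k → Vec Carrier k → Carrier
  evalL : ∀ {k} → List (Poly k) → Vec Carrier k → List Carrier
  eval (con x)   v = x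
  eval (poly cs) v = horner (evalL cs (init v)) (last v)
  evalL []       v = []
  evalL (p ∷ ps) v = eval p v ∷ evalL ps v

  System : ℕ → Set c
  System k = List (Poly k) × List (Poly k)

  InZero : ∀ {k} → System k → Vec Carrier k → Set (c ⊔ ℓ)
  InZero (P , Q) ξ =
    All (λ p → eval p ξ ≈ 0#) P × All (λ q → ¬ (eval q ξ ≈ 0#)) Q

  InProj : ∀ {k} → System (suc k) → Vec Carrier k → Set (c ⊔ ℓ)
  InProj S α = ∃ λ β → InZero S (α Data.Vec.∷ʳ β)

  ProjCoeff : ∀ {k} → List (Poly k × ℕ) → Vec Carrier k → List (System k)
  ProjCoeff cds α = map (λ { (cᵢ , dᵢ) → [] , [ cᵢ -C eval cᵢ α ] }) cds

  sumMonomials : ∀ {k} → List (Poly k × ℕ) → Poly (suc k)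
  sumMonomials = foldr (λ { (cᵢ , dᵢ) acc → monomial cᵢ dᵢ +P acc }) (poly [])

  -- Δ is a weak projecting zero decomposition of A for α
  -- (the systems of Δ lie in F[x_1..x_{k-1}] by typing)
  WeakProjDecomp : ∀ {k} → System (suc k) → Vec Carrier k → List (System k) → Set (c ⊔ ℓ)
  WeakProjDecomp A α Δ =
    (∀ α′ → InProj A α′ → Any (λ S → InZero S α′) Δ)
    × All (λ S → ¬ InZero S α) Δ

{-# OPTIONS --safe #-}
-- If α′ ∈ proj_k zero(P/Q), either some coefficient cᵢ takes a value at α′
-- different from γᵢ = cᵢ(α), so α′ ∈ zero(∅/{cᵢ − γᵢ}), or every coefficient
-- takes the same value at α′ as at α.  In the latter case a(α′, β) = a(α, β)
-- for every β, since a(·, β) = Σ cᵢ(·) βᵈⁱ, so the witness β for α′ would be a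
-- witness for α, contradicting α ∉ proj_k zero(P/Q).  Conversely α itself
-- never lies in zero(∅/{cᵢ − γᵢ}) because cᵢ(α) − γᵢ = 0.
module Submission where

open import Defs
open import Level using (Level; _⊔_; lower)
open import Data.Nat using (ℕ; zero; suc)
open import Data.Product using (_×_; _,_; proj₁; proj₂)
open import Data.Sum using (_⊎_; inj₁; inj₂)
open import Data.Empty using (⊥-elim)
open import Data.List using (List; []; _∷_; [_]; map; replicate; _++_)
open import Data.List.Relation.Unary.AllPairs using (AllPairs)
open import Data.List.Relation.Unary.All using (All; []; _∷_; all?; universal)
open import Data.List.Relation.Unary.Any as Any using (Any)
import Data.List.Relation.Unary.All.Properties as Allₚ
import Data.List.Relation.Unary.Any.Properties as Anyₚ
open import Data.Vec using (Vec; init; last; _∷ʳ_)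
open import Data.Vec.Properties using (init-∷ʳ; last-∷ʳ)
open import Relation.Nullary using (¬_; Dec; yes; no)
open import Relation.Binary.PropositionalEquality using (_≡_; _≢_; refl; cong₂)
import Algebra.Properties.Group as GroupProperties
import Algebra.Properties.CommutativeSemigroup as CommutativeSemigroupProperties
import Relation.Binary.Reasoning.Setoid as SetoidReasoning

module Evaluation {c ℓ : Level} (F : FiniteField c ℓ) where
  open FiniteField F hiding (zero) renaming (refl to ≈-refl)
  open Polynomials F
  open CommutativeSemigroupProperties +-commutativeSemigroup using (interchange)
  open SetoidReasoning setoid

  horner-isZeroL : ∀ {k} (ps : List (Poly k)) → IsZeroL ps → ∀ u β → horner (evalL ps u) β ≈ 0#
  eval-isZeroP : ∀ {k} (p : Poly k) → IsZeroP p → ∀ u → eval p u ≈ 0#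
  horner-isZeroL [] _ u β = ≈-refl
  horner-isZeroL (p ∷ ps) (p≈0 , ps≈0) u β = begin
    eval p u + β * horner (evalL ps u) β
      ≈⟨ +-cong (eval-isZeroP p p≈0 u) (*-congˡ (horner-isZeroL ps ps≈0 u β)) ⟩
    0# + β * 0#                          ≈⟨ +-identityˡ _ ⟩
    β * 0#                               ≈⟨ zeroʳ β ⟩
    0#                                   ∎
  eval-isZeroP (con x) x≈0 u = lower x≈0
  eval-isZeroP (poly ps) ps≈0 u = horner-isZeroL ps ps≈0 (init u) (last u)

  horner-congL : ∀ {k} (ps qs : List (Poly k)) → ps ≃L qs → ∀ u β →
                 horner (evalL ps u) β ≈ horner (evalL qs u) β
  eval-cong : ∀ {k} (p q : Poly k) → p ≃P q → ∀ u → eval p u ≈ eval q u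
  horner-congL [] qs 0≃qs u β = sym (horner-isZeroL qs 0≃qs u β)
  horner-congL (p ∷ ps) [] ps≃0 u β = horner-isZeroL (p ∷ ps) ps≃0 u β
  horner-congL (p ∷ ps) (q ∷ qs) (p≃q , ps≃qs) u β =
    +-cong (eval-cong p q p≃q u) (*-congˡ (horner-congL ps qs ps≃qs u β))
  eval-cong (con x) (con y) x≈y u = lower x≈y
  eval-cong (poly ps) (poly qs) ps≃qs u = horner-congL ps qs ps≃qs (init u) (last u)

  horner-addL : ∀ {k} (ps qs : List (Poly k)) u β →
                horner (evalL (addL _+P_ ps qs) u) β ≈ horner (evalL ps u) β + horner (evalL qs u) β
  eval-+P : ∀ {k} (p q : Poly k) u → eval (p +P q) u ≈ eval p u + eval q u
  horner-addL [] qs u β = sym (+-identityˡ _)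
  horner-addL (p ∷ ps) [] u β = sym (+-identityʳ _)
  horner-addL (p ∷ ps) (q ∷ qs) u β = begin
    eval (p +P q) u + β * horner (evalL (addL _+P_ ps qs) u) β
      ≈⟨ +-cong (eval-+P p q u) (*-congˡ (horner-addL ps qs u β)) ⟩
    (eval p u + eval q u) + β * (horner (evalL ps u) β + horner (evalL qs u) β)
      ≈⟨ +-congˡ (distribˡ β _ _) ⟩
    (eval p u + eval q u) + (β * horner (evalL ps u) β + β * horner (evalL qs u) β)
      ≈⟨ interchange _ _ _ _ ⟩
    (eval p u + β * horner (evalL ps u) β) + (eval q u + β * horner (evalL qs u) β) ∎
  eval-+P (con x) (con y) u = ≈-refl
  eval-+P (poly ps) (poly qs) u = horner-addL ps qs (init u) (last u)

  eval-0P : ∀ {k} u → eval (0P {k}) u ≈ 0#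
  eval-0P {zero} u = ≈-refl
  eval-0P {suc k} u = ≈-refl

  eval-constP : ∀ {k} x u → eval (constP {k} x) u ≈ x
  eval-constP {zero} x u = ≈-refl
  eval-constP {suc k} x u = begin
    eval (constP x) (init u) + last u * 0# ≈⟨ +-cong (eval-constP x (init u)) (zeroʳ _) ⟩
    x + 0#                                 ≈⟨ +-identityʳ x ⟩
    x                                      ∎

  eval--C : ∀ {k} (p : Poly k) γ u → eval (p -C γ) u ≈ eval p u + - γ
  eval--C p γ u = trans (eval-+P p (constP (- γ)) u) (+-congˡ (eval-constP (- γ) u))

  -- γ βᵈ, in the Horner form produced by evaluating monomial c d
  monomialValue : ℕ → Carrier → Carrier → Carrier
  monomialValue d γ β = horner (replicate d 0# ++ [ γ ]) β

  monomialValue-cong : ∀ d {γ γ′} β → γ ≈ γ′ → monomialValue d γ β ≈ monomialValue d γ′ β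
  monomialValue-cong zero β γ≈γ′ = +-congʳ γ≈γ′
  monomialValue-cong (suc d) β γ≈γ′ = +-congˡ (*-congˡ (monomialValue-cong d β γ≈γ′))

  horner-monomial : ∀ {k} d (p : Poly k) u β →
                    horner (evalL (replicate d 0P ++ [ p ]) u) β ≈ monomialValue d (eval p u) β
  horner-monomial zero p u β = ≈-refl
  horner-monomial (suc d) p u β = +-cong (eval-0P u) (*-congˡ (horner-monomial d p u β))

  sumMonomialValues : ∀ {k} → List (Poly k × ℕ) → Vec Carrier k → Carrier → Carrier
  sumMonomialValues [] v β = 0#
  sumMonomialValues ((p , d) ∷ cds) v β = monomialValue d (eval p v) β + sumMonomialValues cds v β

  eval-sumMonomials : ∀ {k} (cds : List (Poly k × ℕ)) w →
                      eval (sumMonomials cds) w ≈ sumMonomialValues cds (init w) (last w)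
  eval-sumMonomials [] w = ≈-refl
  eval-sumMonomials ((p , d) ∷ cds) w =
    trans (eval-+P (monomial p d) (sumMonomials cds) w)
          (+-cong (horner-monomial d p (init w) (last w)) (eval-sumMonomials cds w))

  SameCoefficientValues : ∀ {k} → List (Poly k × ℕ) → Vec Carrier k → Vec Carrier k → Set (c ⊔ ℓ)
  SameCoefficientValues cds v v′ = All (λ (p , _) → eval p v ≈ eval p v′) cds

  sumMonomialValues-cong : ∀ {k} (cds : List (Poly k × ℕ)) {v v′} β →
                           SameCoefficientValues cds v v′ →
                           sumMonomialValues cds v β ≈ sumMonomialValues cds v′ β
  sumMonomialValues-cong [] β [] = ≈-refl
  sumMonomialValues-cong ((p , d) ∷ cds) β (p≈ ∷ cds≈) =
    +-cong (monomialValue-cong d β p≈) (sumMonomialValues-cong cds β cds≈)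

  eval-∷ʳ : ∀ {k} (a : Poly (suc k)) cds → a ≃P sumMonomials cds → ∀ v β →
            eval a (v ∷ʳ β) ≈ sumMonomialValues cds v β
  eval-∷ʳ a cds a≃Σ v β = begin
    eval a (v ∷ʳ β)                                       ≈⟨ eval-cong a _ a≃Σ (v ∷ʳ β) ⟩
    eval (sumMonomials cds) (v ∷ʳ β)                      ≈⟨ eval-sumMonomials cds (v ∷ʳ β) ⟩
    sumMonomialValues cds (init (v ∷ʳ β)) (last (v ∷ʳ β))
      ≡⟨ cong₂ (sumMonomialValues cds) (init-∷ʳ β v) (last-∷ʳ β v) ⟩
    sumMonomialValues cds v β                             ∎

  eval-∷ʳ-cong : ∀ {k} (a : Poly (suc k)) cds → a ≃P sumMonomials cds → ∀ {v v′} β →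
                 SameCoefficientValues cds v v′ → eval a (v ∷ʳ β) ≈ eval a (v′ ∷ʳ β)
  eval-∷ʳ-cong a cds a≃Σ {v} {v′} β v≈v′ = begin
    eval a (v ∷ʳ β)              ≈⟨ eval-∷ʳ a cds a≃Σ v β ⟩
    sumMonomialValues cds v β    ≈⟨ sumMonomialValues-cong cds β v≈v′ ⟩
    sumMonomialValues cds v′ β   ≈⟨ eval-∷ʳ a cds a≃Σ v′ β ⟨
    eval a (v′ ∷ʳ β)             ∎

module CoefficientProjection {c ℓ : Level} (F : FiniteField c ℓ) where
  open FiniteField F hiding (zero; refl)
  open Polynomials F
  open Evaluation F
  open GroupProperties +-group using (x∙y⁻¹≈ε⇒x≈y)

  inZero-shift⁺ : ∀ {k} (p : Poly k) {u v} → ¬ eval p u ≈ eval p v →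
                  InZero ([] , [ p -C eval p v ]) u
  inZero-shift⁺ p {u} {v} p[u]≉p[v] = [] , p[u]-p[v]≉0 ∷ []
    where
    p[u]-p[v]≉0 : ¬ eval (p -C eval p v) u ≈ 0#
    p[u]-p[v]≉0 p[u]-p[v]≈0 =
      p[u]≉p[v] (x∙y⁻¹≈ε⇒x≈y _ _ (trans (sym (eval--C p (eval p v) u)) p[u]-p[v]≈0))

  ¬inZero-shift-self : ∀ {k} (p : Poly k) v → ¬ InZero ([] , [ p -C eval p v ]) v
  ¬inZero-shift-self p v (_ , p[v]-p[v]≉0 ∷ []) =
    p[v]-p[v]≉0 (trans (eval--C p (eval p v) v) (-‿inverseʳ (eval p v)))

  projCoeff-excludes : ∀ {k} (α : Vec Carrier k) cds → All (λ S → ¬ InZero S α) (ProjCoeff cds α)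
  projCoeff-excludes α cds = Allₚ.map⁺ (universal (λ (p , _) → ¬inZero-shift-self p α) cds)

  sameValue? : ∀ {k} (v v′ : Vec Carrier k) (cd : Poly k × ℕ) →
               Dec (eval (proj₁ cd) v ≈ eval (proj₁ cd) v′)
  sameValue? v v′ (p , _) = eval p v ≟ eval p v′

  projCoeff-covers-or-same : ∀ {k} (α α′ : Vec Carrier k) cds →
                             Any (λ S → InZero S α′) (ProjCoeff cds α) ⊎ SameCoefficientValues cds α′ α
  projCoeff-covers-or-same α α′ cds with all? (sameValue? α′ α) cds
  ... | yes same = inj₂ same
  ... | no ¬same = inj₁ (Anyₚ.map⁺ (Any.map (λ {(p , _)} → inZero-shift⁺ p)
                                            (Allₚ.¬All⇒Any¬ (sameValue? α′ α) cds ¬same)))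

  inZero-singleton-cong : ∀ {k} {a : Poly k} {A} → (A ≡ ([ a ] , []) ⊎ A ≡ ([] , [ a ])) →
                          ∀ {ξ ξ′} → eval a ξ ≈ eval a ξ′ → InZero A ξ → InZero A ξ′
  inZero-singleton-cong (inj₁ refl) a≈ (a[ξ]≈0 ∷ [] , []) = trans (sym a≈) a[ξ]≈0 ∷ [] , []
  inZero-singleton-cong (inj₂ refl) a≈ ([] , a[ξ]≉0 ∷ []) =
    [] , (λ a[ξ′]≈0 → a[ξ]≉0 (trans a≈ a[ξ′]≈0)) ∷ []

theorem3 : ∀ {c ℓ : Level} (F : FiniteField c ℓ) (k : ℕ)
    → let open Polynomials F in
    (a : Poly (ℕ.suc k)) (A : System (ℕ.suc k))
    → (A ≡ ([ a ] , []) ⊎ A ≡ ([] , [ a ]))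
    → (α : Vec (FiniteField.Carrier F) k)
    → ¬ InProj A α
    → (cds : List (Poly k × ℕ))
    → AllPairs _≢_ (map proj₂ cds)
    → a ≃P sumMonomials cds
    → WeakProjDecomp A α (ProjCoeff cds α)
theorem3 F k a A A-shape α α∉proj cds _ a≃Σ = covers , projCoeff-excludes α cds
  where
  open Polynomials F
  open Evaluation F
  open CoefficientProjection F

  covers : ∀ α′ → InProj A α′ → Any (λ S → InZero S α′) (ProjCoeff cds α)
  covers α′ (β , α′β∈A) with projCoeff-covers-or-same α α′ cds
  ... | inj₁ covered = covered
  ... | inj₂ same =
    ⊥-elim (α∉proj (β , inZero-singleton-cong A-shape (eval-∷ʳ-cong a cds a≃Σ β same) α′β∈A))
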